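{- Let $G\le\mathrm{Sym}(n)$ be transitive and suppose $H=\mathrm{Der}(G)\cup\{1\}$ is a subgroup of $G$. For every $h\in\mathrm{Der}(G)$, setting $D=\{h,h^{ -1}\}$, $\alpha(\mathrm{Cay}(G,\mathrm{Der}(G)\setminus D))=2\alpha(\Gamma_G)$ if $o(h)\ne 3$, and $=3\alpha(\Gamma_G)$ if $o(h)=3$. In particular, there is no inverse-closed $D\subseteq\mathrm{Der}(G)$ such that $\alpha(\Gamma_G)<\alpha(\mathrm{Cay}(G,\mathrm{Der}(G)\setminus D))<2\alpha(\Gamma_G)$.
   Context: $o(h)$ is the order of $h$. A derangement is a permutation with no fixed point; $\mathrm{Der}(G)$ is the set of derangements of $G$. For inverse-closed $S\subseteq G$ not containing the identity, $\mathrm{Cay}(G,S)$ is the graph on $G$ with $g,k$ adjacent iff $g^{ -1}k\in S$; $\Gamma_G=\mathrm{Cay}(G,\mathrm{Der}(G))$; $\alpha$ denotes independence number. -}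

module Defs where

open import Data.Nat using (ℕ; zero; suc; _<_; _≤_; _*_)
open import Data.Fin using (Fin)
open import Data.Fin.Properties using (any?)
open import Data.Vec using (Vec; lookup; tabulate)
open import Data.List using (List; length)
open import Data.List.Membership.Propositional using (_∈_)
open import Data.List.Relation.Unary.Unique.Propositional using (Unique)
open import Data.Product using (Σ; ∃; _×_; _,_)
open import Relation.Nullary using (¬_; yes; no)
open import Relation.Binary.PropositionalEquality using (_≡_; _≢_)
open import Data.Fin using (_≟_)
open import Data.Sum using (_⊎_)

-- A map Fin n → Fin n, stored as its table of values (so equality is ≡).
Map : ℕ → Set
Map n = Vec (Fin n) n

IsPerm : ∀ {n} → Map n → Set
IsPerm {n} σ = ∀ (i j : Fin n) → lookup σ i ≡ lookup σ j → i ≡ j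

idP : ∀ {n} → Map n
idP = tabulate (λ i → i)

mul : ∀ {n} → Map n → Map n → Map n
mul σ τ = tabulate (λ i → lookup σ (lookup τ i))

-- inverse: σ⁻¹(j) = the i with σ(i) = j (correct for permutations)
inv : ∀ {n} → Map n → Map n
inv σ = tabulate (λ j → pick j (any? (λ i → lookup σ i ≟ j)))
  where
  pick : ∀ {n} {P : Fin n → Set} → Fin n → Relation.Nullary.Dec (∃ P) → Fin n
  pick j (yes (i , _)) = i
  pick j (no _)        = j

pow : ∀ {n} → Map n → ℕ → Map n
pow σ zero    = idP
pow σ (suc k) = mul σ (pow σ k)

HasOrder : ∀ {n} → Map n → ℕ → Set
HasOrder σ k = 0 < k × pow σ k ≡ idP × (∀ m → 0 < m → m < k → pow σ m ≢ idP)

Subset : ℕ → Set₁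
Subset n = Map n → Set

IsPermGroup : ∀ {n} → Subset n → Set
IsPermGroup {n} G =
  (∀ σ → G σ → IsPerm σ) ×
  G idP ×
  (∀ σ τ → G σ → G τ → G (mul σ τ)) ×
  (∀ σ → G σ → G (inv σ))

IsSubgroupOf : ∀ {n} → Subset n → Subset n → Set
IsSubgroupOf {n} H G =
  (∀ σ → H σ → G σ) ×
  H idP ×
  (∀ σ τ → H σ → H τ → H (mul σ τ)) ×
  (∀ σ → H σ → H (inv σ))

IsTransitive : ∀ {n} → Subset n → Set
IsTransitive {n} G = ∀ (i j : Fin n) → ∃ λ σ → G σ × lookup σ i ≡ j

IsDerangement : ∀ {n} → Map n → Set
IsDerangement σ = ∀ i → lookup σ i ≢ i

Der : ∀ {n} → Subset n → Subset n
Der G σ = G σ × IsDerangement σ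

DerId : ∀ {n} → Subset n → Subset n
DerId G σ = Der G σ ⊎ (σ ≡ idP)

CayAdj : ∀ {n} → Subset n → Map n → Map n → Set
CayAdj S g k = S (mul (inv g) k)

IsIndependent : ∀ {n} → Subset n → Subset n → List (Map n) → Set
IsIndependent G S L =
  Unique L × (∀ x → x ∈ L → G x) × (∀ x y → x ∈ L → y ∈ L → ¬ CayAdj S x y)

IsIndepNumber : ∀ {n} → Subset n → Subset n → ℕ → Set
IsIndepNumber G S a =
  (∃ λ L → IsIndependent G S L × length L ≡ a) ×
  (∀ L → IsIndependent G S L → length L ≤ a)

_∖_ : ∀ {n} → Subset n → Subset n → Subset n
(S ∖ D) σ = S σ × ¬ D σ

Pair : ∀ {n} → Map n → Subset n
Pair h σ = (σ ≡ h) ⊎ (σ ≡ inv h)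

module Submission where

-- Since H = Der(G) ∪ {1} is a subgroup, two elements of G are adjacent in Γ_G exactly when
-- they are distinct and lie in the same left coset of H. So a maximum independent set of Γ_G
-- is a transversal of the cosets, and an independent set of Cay(G, Der(G) ∖ D) meets every
-- coset in a clique of Cay(G, D); hence α(Cay(G, Der(G) ∖ D)) = α(Γ_G) · ω, where ω is the
-- largest size of a clique of Cay(H, D), and a transversal times such a clique attains it.
-- For D = {h, h⁻¹}, three pairwise adjacent vertices x, xa, xb force {a, b} = {h, h⁻¹} and
-- a⁻¹b ∈ {h, h⁻¹}, i.e. o(h) = 3; so ω = 3 with the clique {1, h, h⁻¹} if o(h) = 3, and
-- ω = 2 otherwise. Any nonempty inverse-closed D ⊆ Der(G) has the clique {1, d}, so ω ≥ 2.

open import Defs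
open import Data.Nat using (ℕ; zero; suc; _≤_; _<_; _*_; _+_; z≤n; s≤s)
open import Data.Nat.Properties using (+-mono-≤; +-suc; *-comm; n<1+n; 1+n≰n; <⇒≱; module ≤-Reasoning)
open import Data.Fin using (Fin; punchOut; fromℕ<) renaming (_≟_ to _≟ᶠ_)
open import Data.Fin.Properties using (any?; all?; pigeonhole; punchOut-injective; <-irrefl)
open import Data.Vec using (lookup)
open import Data.Vec.Properties using (lookup∘tabulate; tabulate∘lookup; tabulate-cong; ≡-dec)
open import Data.List using (List; []; _∷_; length; map; filter; cartesianProduct)
open import Data.List.Properties using (length-map; length-++)
open import Data.List.Membership.Propositional using (_∈_)
open import Data.List.Membership.Propositional.Properties using (∈-map⁻; ∈-cartesianProduct⁻; ∈-filter⁻)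
open import Data.List.Relation.Unary.Any as Any using (Any; here; there)
open import Data.List.Relation.Unary.All as All using (All; []; _∷_)
open import Data.List.Relation.Unary.All.Properties using (all-filter) renaming (filter⁺ to All-filter⁺)
open import Data.List.Relation.Unary.AllPairs using (AllPairs; []; _∷_)
import Data.List.Relation.Unary.AllPairs.Properties as AllPairs
open import Data.List.Relation.Unary.Unique.Propositional using (Unique)
import Data.List.Relation.Unary.Unique.Propositional.Properties as Unique
open import Data.Product using (∃; _×_; _,_; proj₁; proj₂; uncurry)
open import Data.Sum using (_⊎_; inj₁; inj₂)
open import Data.Empty using (⊥; ⊥-elim)
open import Function using (_∘_; _∋_)
open import Relation.Nullary using (¬_; Dec; yes; no; ¬?)
open import Relation.Nullary.Decidable using (_⊎-dec_; decidable-stable)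
open import Relation.Unary using (Decidable)
open import Relation.Binary.PropositionalEquality

module _ {A : Set} where

  Unique⇒AllPairs : ∀ {R : A → A → Set} {xs} → Unique xs →
    (∀ {x y} → x ∈ xs → y ∈ xs → x ≢ y → R x y) → AllPairs R xs
  Unique⇒AllPairs [] rel = []
  Unique⇒AllPairs (x∉xs ∷ u) rel =
    All.tabulate (λ y∈ → rel (here refl) (there y∈) (All.lookup x∉xs y∈))
    ∷ Unique⇒AllPairs u (λ x∈ y∈ → rel (there x∈) (there y∈))

  AllPairs⇒∈-related : ∀ {R : A → A → Set} {xs x y} → AllPairs R xs → x ∈ xs → y ∈ xs →
    x ≡ y ⊎ R x y ⊎ R y x
  AllPairs⇒∈-related (rx ∷ _) (here refl) (here refl) = inj₁ refl
  AllPairs⇒∈-related (rx ∷ _) (here refl) (there y∈) = inj₂ (inj₁ (All.lookup rx y∈))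
  AllPairs⇒∈-related (rx ∷ _) (there x∈) (here refl) = inj₂ (inj₂ (All.lookup rx x∈))
  AllPairs⇒∈-related (_ ∷ r) (there x∈) (there y∈) = AllPairs⇒∈-related r x∈ y∈

  length-filter+filter-¬ : ∀ {P : A → Set} (P? : Decidable P) xs →
    length xs ≡ length (filter P? xs) + length (filter (¬? ∘ P?) xs)
  length-filter+filter-¬ P? [] = refl
  length-filter+filter-¬ P? (x ∷ xs) with P? x
  ... | yes _ = cong suc (length-filter+filter-¬ P? xs)
  ... | no _ = trans (cong suc (length-filter+filter-¬ P? xs)) (sym (+-suc _ _))

length-cartesianProduct : ∀ {A B : Set} (xs : List A) (ys : List B) →
  length (cartesianProduct xs ys) ≡ length xs * length ys
length-cartesianProduct [] ys = refl
length-cartesianProduct (x ∷ xs) ys =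
  trans (length-++ (map (x ,_) ys)) (cong₂ _+_ (length-map (x ,_) ys) (length-cartesianProduct xs ys))

module _ {A B : Set} {R : A → B → Set} (R? : ∀ x b → Dec (R x b)) (c : ℕ) where

  length≤fibres : ∀ bs xs → Unique xs → All (λ x → Any (R x) bs) xs →
    (∀ {b} ys → b ∈ bs → Unique ys → (∀ {y} → y ∈ ys → y ∈ xs) → All (λ y → R y b) ys → length ys ≤ c) →
    length xs ≤ length bs * c
  length≤fibres [] [] _ _ _ = z≤n
  length≤fibres [] (x ∷ xs) _ (() ∷ _) _
  length≤fibres (b ∷ bs) xs u covered fibre = begin
      length xs                    ≡⟨ length-filter+filter-¬ (λ x → R? x b) xs ⟩
      length inFibre + length rest ≤⟨ +-mono-≤ fibre-b rest-bound ⟩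
      c + length bs * c            ∎
    where
    open ≤-Reasoning
    inFibre rest : List A
    inFibre = filter (λ x → R? x b) xs
    rest = filter (λ x → ¬? (R? x b)) xs
    fibre-b : length inFibre ≤ c
    fibre-b = fibre inFibre (here refl) (Unique.filter⁺ _ u) (proj₁ ∘ ∈-filter⁻ _) (all-filter _ xs)
    still-covered : ∀ {x} → Any (R x) (b ∷ bs) × ¬ R x b → Any (R x) bs
    still-covered (here r , ¬r) = ⊥-elim (¬r r)
    still-covered (there a , _) = a
    rest-bound : length rest ≤ length bs * c
    rest-bound = length≤fibres bs rest (Unique.filter⁺ _ u)
      (All.zipWith still-covered (All-filter⁺ _ covered , all-filter _ xs))
      (λ ys b∈ u' ⊆rest → fibre ys (there b∈) u' (proj₁ ∘ ∈-filter⁻ _ ∘ ⊆rest))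

IsPerm⇒surjective : ∀ {n} (σ : Map n) → IsPerm σ → ∀ j → ∃ λ i → lookup σ i ≡ j
IsPerm⇒surjective {zero} _ _ ()
IsPerm⇒surjective {suc m} σ σ-inj j with any? (λ i → lookup σ i ≟ᶠ j)
... | yes hit = hit
... | no miss =
  let i , k , i<k , eq = pigeonhole (n<1+n m) (λ i → punchOut (missed i))
  in ⊥-elim (<-irrefl (σ-inj i k (punchOut-injective (missed i) (missed k) eq)) i<k)
  where
  missed : ∀ i → j ≢ lookup σ i
  missed i eq = miss (i , sym eq)

module _ {n : ℕ} where

  Map-ext : {σ τ : Map n} → (∀ i → lookup σ i ≡ lookup τ i) → σ ≡ τ
  Map-ext {σ} {τ} p = trans (sym (tabulate∘lookup σ)) (trans (tabulate-cong p) (tabulate∘lookup τ))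

  lookup-mul : (σ τ : Map n) (i : Fin n) → lookup (mul σ τ) i ≡ lookup σ (lookup τ i)
  lookup-mul σ τ i = lookup∘tabulate _ i

  lookup-idP : (i : Fin n) → lookup idP i ≡ i
  lookup-idP i = lookup∘tabulate _ i

  lookup-inv-preimage : (σ : Map n) (j : Fin n) → (∃ λ i → lookup σ i ≡ j) →
    lookup σ (lookup (inv σ) j) ≡ j
  lookup-inv-preimage σ j found rewrite (lookup (inv σ) j ≡ _ ∋ lookup∘tabulate _ j)
    with any? (λ i → lookup σ i ≟ᶠ j)
  ... | yes (i , σi≡j) = σi≡j
  ... | no none = ⊥-elim (none found)

  lookup-lookup-inv : ∀ σ → IsPerm σ → ∀ j → lookup σ (lookup (inv σ) j) ≡ j
  lookup-lookup-inv σ σ-inj j = lookup-inv-preimage σ j (IsPerm⇒surjective σ σ-inj j)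

  lookup-inv-lookup : ∀ σ → IsPerm σ → ∀ i → lookup (inv σ) (lookup σ i) ≡ i
  lookup-inv-lookup σ σ-inj i = σ-inj _ _ (lookup-inv-preimage σ _ (i , refl))

  idP-IsPerm : IsPerm (idP {n})
  idP-IsPerm i j eq = trans (sym (lookup-idP i)) (trans eq (lookup-idP j))

  mul-preserves-IsPerm : ∀ σ τ → IsPerm σ → IsPerm τ → IsPerm (mul σ τ)
  mul-preserves-IsPerm σ τ σ-inj τ-inj i j eq =
    τ-inj i j (σ-inj _ _ (trans (sym (lookup-mul σ τ i)) (trans eq (lookup-mul σ τ j))))

  inv-preserves-IsPerm : ∀ σ → IsPerm σ → IsPerm (inv σ)
  inv-preserves-IsPerm σ σ-inj i j eq =
    trans (sym (lookup-lookup-inv σ σ-inj i)) (trans (cong (lookup σ) eq) (lookup-lookup-inv σ σ-inj j))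

  mul-assoc : (σ τ ρ : Map n) → mul (mul σ τ) ρ ≡ mul σ (mul τ ρ)
  mul-assoc σ τ ρ = Map-ext λ i → begin
      lookup (mul (mul σ τ) ρ) i       ≡⟨ lookup-mul (mul σ τ) ρ i ⟩
      lookup (mul σ τ) (lookup ρ i)    ≡⟨ lookup-mul σ τ (lookup ρ i) ⟩
      lookup σ (lookup τ (lookup ρ i)) ≡⟨ cong (lookup σ) (lookup-mul τ ρ i) ⟨
      lookup σ (lookup (mul τ ρ) i)    ≡⟨ lookup-mul σ (mul τ ρ) i ⟨
      lookup (mul σ (mul τ ρ)) i       ∎
    where open ≡-Reasoning

  mul-identityˡ : (σ : Map n) → mul idP σ ≡ σ
  mul-identityˡ σ = Map-ext λ i → trans (lookup-mul idP σ i) (lookup-idP _)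

  mul-identityʳ : (σ : Map n) → mul σ idP ≡ σ
  mul-identityʳ σ = Map-ext λ i → trans (lookup-mul σ idP i) (cong (lookup σ) (lookup-idP i))

  inverseˡ : ∀ σ → IsPerm σ → mul (inv σ) σ ≡ idP
  inverseˡ σ σ-inj = Map-ext λ i →
    trans (lookup-mul (inv σ) σ i) (trans (lookup-inv-lookup σ σ-inj i) (sym (lookup-idP i)))

  inverseʳ : ∀ σ → IsPerm σ → mul σ (inv σ) ≡ idP
  inverseʳ σ σ-inj = Map-ext λ i →
    trans (lookup-mul σ (inv σ) i) (trans (lookup-lookup-inv σ σ-inj i) (sym (lookup-idP i)))

  mul-cancelˡ : ∀ σ → IsPerm σ → {τ ρ : Map n} → mul σ τ ≡ mul σ ρ → τ ≡ ρ
  mul-cancelˡ σ σ-inj {τ} {ρ} eq = Map-ext λ i →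
    σ-inj _ _ (trans (sym (lookup-mul σ τ i)) (trans (cong (λ g → lookup g i) eq) (lookup-mul σ ρ i)))

  inv-unique : ∀ σ → IsPerm σ → {τ : Map n} → mul σ τ ≡ idP → τ ≡ inv σ
  inv-unique σ σ-inj eq = mul-cancelˡ σ σ-inj (trans eq (sym (inverseʳ σ σ-inj)))

  inv-involutive : ∀ σ → IsPerm σ → inv (inv σ) ≡ σ
  inv-involutive σ σ-inj = sym (inv-unique (inv σ) (inv-preserves-IsPerm σ σ-inj) (inverseˡ σ σ-inj))

  inv-idP : inv (idP {n}) ≡ idP
  inv-idP = sym (inv-unique idP idP-IsPerm (mul-identityˡ idP))

  inv≢idP : ∀ σ → IsPerm σ → σ ≢ idP → inv σ ≢ idP
  inv≢idP σ σ-inj σ≢idP σ⁻¹≡idP = σ≢idP (begin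
      σ            ≡⟨ mul-identityʳ σ ⟨
      mul σ idP    ≡⟨ cong (mul σ) σ⁻¹≡idP ⟨
      mul σ (inv σ) ≡⟨ inverseʳ σ σ-inj ⟩
      idP          ∎)
    where open ≡-Reasoning

  derangement≢idP : Fin n → {σ : Map n} → IsDerangement σ → σ ≢ idP
  derangement≢idP i σ-der refl = σ-der i (lookup-idP i)

  IsDerangement? : (σ : Map n) → Dec (IsDerangement σ)
  IsDerangement? σ = all? (λ i → ¬? (lookup σ i ≟ᶠ i))

  _≟_ : (σ τ : Map n) → Dec (σ ≡ τ)
  _≟_ = ≡-dec _≟ᶠ_

  infixl 7 _⁻¹·_
  _⁻¹·_ : Map n → Map n → Map n
  x ⁻¹· y = mul (inv x) y

  idP-⁻¹· : (x : Map n) → idP ⁻¹· x ≡ x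
  idP-⁻¹· x = trans (cong (λ g → mul g x) inv-idP) (mul-identityˡ x)

  ⁻¹·-mul : ∀ x → IsPerm x → (e : Map n) → x ⁻¹· mul x e ≡ e
  ⁻¹·-mul x x-inj e = begin
      mul (inv x) (mul x e) ≡⟨ mul-assoc (inv x) x e ⟨
      mul (mul (inv x) x) e ≡⟨ cong (λ g → mul g e) (inverseˡ x x-inj) ⟩
      mul idP e             ≡⟨ mul-identityˡ e ⟩
      e                     ∎
    where open ≡-Reasoning

  ⁻¹·-∙ : (x : Map n) → ∀ y → IsPerm y → (z : Map n) → mul (x ⁻¹· y) (y ⁻¹· z) ≡ x ⁻¹· z
  ⁻¹·-∙ x y y-inj z = begin
      mul (mul (inv x) y) (mul (inv y) z) ≡⟨ mul-assoc (inv x) y (mul (inv y) z) ⟩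
      mul (inv x) (mul y (mul (inv y) z)) ≡⟨ cong (mul (inv x)) (mul-assoc y (inv y) z) ⟨
      mul (inv x) (mul (mul y (inv y)) z) ≡⟨ cong (λ g → mul (inv x) (mul g z)) (inverseʳ y y-inj) ⟩
      mul (inv x) (mul idP z)             ≡⟨ cong (mul (inv x)) (mul-identityˡ z) ⟩
      mul (inv x) z                       ∎
    where open ≡-Reasoning

  inv-⁻¹· : ∀ x y → IsPerm x → IsPerm y → inv (x ⁻¹· y) ≡ y ⁻¹· x
  inv-⁻¹· x y x-inj y-inj = sym (inv-unique (x ⁻¹· y)
    (mul-preserves-IsPerm (inv x) y (inv-preserves-IsPerm x x-inj) y-inj)
    (trans (⁻¹·-∙ x y y-inj x) (inverseˡ x x-inj)))

  ⁻¹·-translate : ∀ x y → IsPerm x → IsPerm y → (z : Map n) → (x ⁻¹· y) ⁻¹· (x ⁻¹· z) ≡ y ⁻¹· z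
  ⁻¹·-translate x y x-inj y-inj z =
    trans (cong (λ g → mul g (x ⁻¹· z)) (inv-⁻¹· x y x-inj y-inj)) (⁻¹·-∙ y x x-inj z)

  ⁻¹·-mul-mul : ∀ x e → IsPerm x → IsPerm e → (e' : Map n) → mul x e ⁻¹· mul x e' ≡ e ⁻¹· e'
  ⁻¹·-mul-mul x e x-inj e-inj e' = begin
      mul x e ⁻¹· mul x e'                 ≡⟨ ⁻¹·-translate x (mul x e) x-inj xe-inj (mul x e') ⟨
      (x ⁻¹· mul x e) ⁻¹· (x ⁻¹· mul x e') ≡⟨ cong₂ _⁻¹·_ (⁻¹·-mul x x-inj e) (⁻¹·-mul x x-inj e') ⟩
      e ⁻¹· e'                             ∎
    where
    open ≡-Reasoning
    xe-inj = mul-preserves-IsPerm x e x-inj e-inj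

  ⁻¹·-cancelˡ : ∀ x → IsPerm x → {y z : Map n} → x ⁻¹· y ≡ x ⁻¹· z → y ≡ z
  ⁻¹·-cancelˡ x x-inj = mul-cancelˡ (inv x) (inv-preserves-IsPerm x x-inj)

  ⁻¹·≡idP⇒≡ : ∀ x → IsPerm x → {y : Map n} → x ⁻¹· y ≡ idP → x ≡ y
  ⁻¹·≡idP⇒≡ x x-inj eq = ⁻¹·-cancelˡ x x-inj (trans (inverseˡ x x-inj) (sym eq))

  CayAdj-sym : {S : Subset n} → (∀ σ → S σ → S (inv σ)) →
    ∀ x y → IsPerm x → IsPerm y → CayAdj S x y → CayAdj S y x
  CayAdj-sym {S} S-inv x y x-inj y-inj adj = subst S (inv-⁻¹· x y x-inj y-inj) (S-inv _ adj)

  _⊗_ : List (Map n) → List (Map n) → List (Map n)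
  L ⊗ E = map (uncurry mul) (cartesianProduct L E)

  length-⊗ : (L E : List (Map n)) → length (L ⊗ E) ≡ length L * length E
  length-⊗ L E = trans (length-map (uncurry mul) (cartesianProduct L E)) (length-cartesianProduct L E)

  ∈-⊗⁻ : ∀ {L E z} → z ∈ L ⊗ E → ∃ λ x → ∃ λ e → x ∈ L × e ∈ E × z ≡ mul x e
  ∈-⊗⁻ {L} {E} z∈ with ∈-map⁻ (uncurry mul) z∈
  ... | (x , e) , xe∈ , refl = let x∈ , e∈ = ∈-cartesianProduct⁻ L E xe∈ in x , e , x∈ , e∈ , refl

module PairProperties {n : ℕ} (h : Map n) (h-inj : IsPerm h) (h≢idP : h ≢ idP) where

  private
    k : Map n
    k = inv h
    k-inj : IsPerm k
    k-inj = inv-preserves-IsPerm h h-inj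

  idP∉Pair : ¬ Pair h idP
  idP∉Pair (inj₁ idP≡h) = h≢idP (sym idP≡h)
  idP∉Pair (inj₂ idP≡k) = inv≢idP h h-inj h≢idP (sym idP≡k)

  Pair-inv : ∀ σ → Pair h σ → Pair h (inv σ)
  Pair-inv σ (inj₁ refl) = inj₂ refl
  Pair-inv σ (inj₂ refl) = inj₁ (inv-involutive h h-inj)

  Pair? : ∀ σ → Dec (Pair h σ)
  Pair? σ = (σ ≟ h) ⊎-dec (σ ≟ inv h)

  Pair-pigeonhole : ∀ {u v w} → Pair h u → Pair h v → Pair h w → u ≡ v ⊎ u ≡ w ⊎ v ≡ w
  Pair-pigeonhole (inj₁ refl) (inj₁ refl) _ = inj₁ refl
  Pair-pigeonhole (inj₂ refl) (inj₂ refl) _ = inj₁ refl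
  Pair-pigeonhole (inj₁ refl) (inj₂ refl) (inj₁ refl) = inj₂ (inj₁ refl)
  Pair-pigeonhole (inj₁ refl) (inj₂ refl) (inj₂ refl) = inj₂ (inj₂ refl)
  Pair-pigeonhole (inj₂ refl) (inj₁ refl) (inj₁ refl) = inj₂ (inj₂ refl)
  Pair-pigeonhole (inj₂ refl) (inj₁ refl) (inj₂ refl) = inj₂ (inj₁ refl)

  pow-3 : pow h 3 ≡ mul h (mul h h)
  pow-3 = cong (mul h) (cong (mul h) (mul-identityʳ h))

  hasOrder3 : mul h h ≢ idP → mul h (mul h h) ≡ idP → HasOrder h 3
  hasOrder3 h²≢idP h³≡idP = s≤s z≤n , trans pow-3 h³≡idP , lower
    where
    lower : ∀ m → 0 < m → m < 3 → pow h m ≢ idP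
    lower 1 _ _ h¹≡idP = h≢idP (trans (sym (mul-identityʳ h)) h¹≡idP)
    lower 2 _ _ h²≡idP = h²≢idP (trans (sym (cong (mul h) (mul-identityʳ h))) h²≡idP)
    lower (suc (suc (suc _))) _ (s≤s (s≤s (s≤s ())))

  square∈Pair⇒order3 : Pair h (mul h h) → HasOrder h 3
  square∈Pair⇒order3 (inj₁ h²≡h) =
    ⊥-elim (h≢idP (mul-cancelˡ h h-inj (trans h²≡h (sym (mul-identityʳ h)))))
  square∈Pair⇒order3 (inj₂ h²≡k) =
    hasOrder3 (λ h²≡idP → inv≢idP h h-inj h≢idP (trans (sym h²≡k) h²≡idP))
              (trans (cong (mul h) h²≡k) (inverseʳ h h-inj))

  -- Unless a = b, one of a⁻¹b and b⁻¹a is h², which therefore lies in {h, h⁻¹}.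
  triangle⇒order3 : ∀ {a b} → Pair h a → Pair h b → Pair h (a ⁻¹· b) → HasOrder h 3
  triangle⇒order3 (inj₁ refl) (inj₁ refl) p = ⊥-elim (idP∉Pair (subst (Pair h) (inverseˡ h h-inj) p))
  triangle⇒order3 (inj₂ refl) (inj₂ refl) p = ⊥-elim (idP∉Pair (subst (Pair h) (inverseˡ k k-inj) p))
  triangle⇒order3 (inj₁ refl) (inj₂ refl) p = square∈Pair⇒order3 (subst (Pair h)
    (trans (inv-⁻¹· h k h-inj k-inj) (cong (λ g → mul g h) (inv-involutive h h-inj))) (Pair-inv _ p))
  triangle⇒order3 (inj₂ refl) (inj₁ refl) p = square∈Pair⇒order3 (subst (Pair h)
    (cong (λ g → mul g h) (inv-involutive h h-inj)) p)

  order3⇒inv²≡ : HasOrder h 3 → mul k k ≡ h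
  order3⇒inv²≡ (_ , h³≡idP , _) = begin
      mul k k          ≡⟨ cong (mul k) h²≡k ⟨
      mul k (mul h h)  ≡⟨ ⁻¹·-mul h h-inj h ⟩
      h                ∎
    where
    open ≡-Reasoning
    h²≡k : mul h h ≡ k
    h²≡k = inv-unique h h-inj (trans (sym pow-3) h³≡idP)

module CosetCounting {n : ℕ} (i₀ : Fin n) (G : Subset n) (G-group : IsPermGroup G)
                     (H-subgroup : IsSubgroupOf (DerId G) G) where

  H : Subset n
  H = DerId G

  perm : ∀ x → G x → IsPerm x
  perm = proj₁ G-group

  G-mul : ∀ x y → G x → G y → G (mul x y)
  G-mul = proj₁ (proj₂ (proj₂ G-group))

  G-⁻¹· : ∀ x y → G x → G y → G (x ⁻¹· y)
  G-⁻¹· x y gx gy = G-mul (inv x) y (proj₂ (proj₂ (proj₂ G-group)) x gx) gy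

  H⊆G : ∀ σ → H σ → G σ
  H⊆G = proj₁ H-subgroup

  H-mul : ∀ σ τ → H σ → H τ → H (mul σ τ)
  H-mul = proj₁ (proj₂ (proj₂ H-subgroup))

  H-inv : ∀ σ → H σ → H (inv σ)
  H-inv = proj₂ (proj₂ (proj₂ H-subgroup))

  ¬Der-⁻¹·-self : ∀ x → G x → ¬ Der G (x ⁻¹· x)
  ¬Der-⁻¹·-self x gx (_ , der) = derangement≢idP i₀ der (inverseˡ x (perm x gx))

  Der-inv : ∀ σ → Der G σ → Der G (inv σ)
  Der-inv σ σ-der with H-inv σ (inj₁ σ-der)
  ... | inj₁ σ⁻¹-der = σ⁻¹-der
  ... | inj₂ σ⁻¹≡idP =
    ⊥-elim (inv≢idP σ (perm σ (proj₁ σ-der)) (derangement≢idP i₀ (proj₂ σ-der)) σ⁻¹≡idP)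

  -- For x, y ∈ G this says xH = yH; G is left out so that it is decidable.
  data _∼_ (x y : Map n) : Set where
    equal : x ≡ y → x ∼ y
    apart : IsDerangement (x ⁻¹· y) → x ∼ y

  _∼?_ : ∀ x y → Dec (x ∼ y)
  x ∼? y with x ≟ y | IsDerangement? (x ⁻¹· y)
  ... | yes x≡y | _ = yes (equal x≡y)
  ... | no _ | yes der = yes (apart der)
  ... | no x≢y | no ¬der = no λ { (equal x≡y) → x≢y x≡y ; (apart der) → ¬der der }

  ∼⇒H : ∀ {x y} → G x → G y → x ∼ y → H (x ⁻¹· y)
  ∼⇒H {x} gx _ (equal refl) = inj₂ (inverseˡ x (perm x gx))
  ∼⇒H {x} {y} gx gy (apart der) = inj₁ (G-⁻¹· x y gx gy , der)

  H⇒∼ : ∀ x y → G x → H (x ⁻¹· y) → x ∼ y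
  H⇒∼ x y gx (inj₁ (_ , der)) = apart der
  H⇒∼ x y gx (inj₂ x⁻¹y≡idP) = equal (⁻¹·≡idP⇒≡ x (perm x gx) x⁻¹y≡idP)

  ∼-sym : ∀ {x y} → G x → G y → x ∼ y → y ∼ x
  ∼-sym {x} {y} gx gy x∼y =
    H⇒∼ y x gy (subst H (inv-⁻¹· x y (perm x gx) (perm y gy)) (H-inv _ (∼⇒H gx gy x∼y)))

  ∼-trans : ∀ {x y z} → G x → G y → G z → x ∼ y → y ∼ z → x ∼ z
  ∼-trans {x} {y} {z} gx gy gz x∼y y∼z =
    H⇒∼ x z gx (subst H (⁻¹·-∙ x y (perm y gy) z) (H-mul _ _ (∼⇒H gx gy x∼y) (∼⇒H gy gz y∼z)))

  ∼-mul : ∀ {x e} → G x → H e → x ∼ mul x e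
  ∼-mul {x} {e} gx he = H⇒∼ x (mul x e) gx (subst H (sym (⁻¹·-mul x (perm x gx) e)) he)

  independent-∼⇒≡ : ∀ {L x y} → IsIndependent G (Der G) L → x ∈ L → y ∈ L → x ∼ y → x ≡ y
  independent-∼⇒≡ _ _ _ (equal x≡y) = x≡y
  independent-∼⇒≡ {x = x} {y} (_ , L⊆G , indep) x∈ y∈ (apart der) =
    ⊥-elim (indep x y x∈ y∈ (G-⁻¹· x y (L⊆G x x∈) (L⊆G y y∈) , der))

  independent-∷ : ∀ {L x} → IsIndependent G (Der G) L → G x → ¬ Any (_∼ x) L →
    IsIndependent G (Der G) (x ∷ L)
  independent-∷ {L} {x} (L-unique , L⊆G , indep) gx x-new =
    All.tabulate (λ ℓ∈ x≡ℓ → x-new (Any.map (λ ℓ≡m → equal (trans (sym ℓ≡m) (sym x≡ℓ))) ℓ∈)) ∷ L-unique ,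
    ⊆G , nonadjacent
    where
    ⊆G : ∀ y → y ∈ x ∷ L → G y
    ⊆G y (here refl) = gx
    ⊆G y (there y∈) = L⊆G y y∈
    nonadjacent : ∀ u v → u ∈ x ∷ L → v ∈ x ∷ L → ¬ CayAdj (Der G) u v
    nonadjacent u v (here refl) (here refl) der = ¬Der-⁻¹·-self x gx der
    nonadjacent u v (here refl) (there v∈) der =
      x-new (Any.map (λ { refl → ∼-sym gx (L⊆G v v∈) (apart (proj₂ der)) }) v∈)
    nonadjacent u v (there u∈) (here refl) der = x-new (Any.map (λ { refl → apart (proj₂ der) }) u∈)
    nonadjacent u v (there u∈) (there v∈) = indep u v u∈ v∈

  maximum-independent-covers : ∀ {L x} → IsIndependent G (Der G) L →
    (∀ L' → IsIndependent G (Der G) L' → length L' ≤ length L) → G x → Any (_∼ x) L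
  maximum-independent-covers {L} {x} L-indep maximal gx with Any.any? (_∼? x) L
  ... | yes covered = covered
  ... | no uncovered = ⊥-elim (1+n≰n (maximal (x ∷ L) (independent-∷ L-indep gx uncovered)))

  CliquesBoundedBy : Subset n → ℕ → Set
  CliquesBoundedBy D c = ∀ F → All G F → AllPairs (CayAdj D) F → length F ≤ c

  coset-clique : ∀ {D L ℓ ys} → (∀ σ → Dec (D σ)) → IsIndependent G (Der G ∖ D) L → G ℓ →
    Unique ys → (∀ {y} → y ∈ ys → y ∈ L) → All (ℓ ∼_) ys → AllPairs (CayAdj D) ys
  coset-clique {D} {ys = ys} D? (_ , L⊆G , L-indep) gℓ ys-unique ys⊆L ℓ∼ys =
    Unique⇒AllPairs ys-unique adjacent
    where
    adjacent : ∀ {x y} → x ∈ ys → y ∈ ys → x ≢ y → CayAdj D x y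
    adjacent {x} {y} x∈ y∈ x≢y =
      mates (∼-trans gx gℓ gy (∼-sym gℓ gx (All.lookup ℓ∼ys x∈)) (All.lookup ℓ∼ys y∈))
      where
      gx : G x
      gx = L⊆G x (ys⊆L x∈)
      gy : G y
      gy = L⊆G y (ys⊆L y∈)
      mates : x ∼ y → CayAdj D x y
      mates (equal x≡y) = ⊥-elim (x≢y x≡y)
      mates (apart der) = decidable-stable (D? _)
        λ ¬d → L-indep x y (ys⊆L x∈) (ys⊆L y∈) ((G-⁻¹· x y gx gy , der) , ¬d)

  independent-length≤ : ∀ {D c a} → (∀ σ → Dec (D σ)) → IsIndepNumber G (Der G) a →
    CliquesBoundedBy D c → ∀ L → IsIndependent G (Der G ∖ D) L → length L ≤ c * a
  independent-length≤ {c = c} D? ((L₀ , L₀-indep , refl) , maximal) bound L L-indep@(L-unique , L⊆G , _) =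
    subst (length L ≤_) (*-comm (length L₀) c)
      (length≤fibres (λ x ℓ → ℓ ∼? x) c L₀ L L-unique covered fibre)
    where
    covered : All (λ x → Any (_∼ x) L₀) L
    covered = All.tabulate λ x∈ → maximum-independent-covers L₀-indep maximal (L⊆G _ x∈)
    fibre : ∀ {ℓ} ys → ℓ ∈ L₀ → Unique ys → (∀ {y} → y ∈ ys → y ∈ L) → All (ℓ ∼_) ys → length ys ≤ c
    fibre {ℓ} ys ℓ∈ ys-unique ys⊆L ℓ∼ys = bound ys (All.tabulate (λ y∈ → L⊆G _ (ys⊆L y∈)))
      (coset-clique D? L-indep (proj₁ (proj₂ L₀-indep) ℓ ℓ∈) ys-unique ys⊆L ℓ∼ys)

  ⊗-same-row : ∀ {L E x y e e'} → IsIndependent G (Der G) L → All H E →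
    x ∈ L → y ∈ L → e ∈ E → e' ∈ E → mul x e ∼ mul y e' → x ≡ y
  ⊗-same-row {x = x} {y} {e} {e'} L-indep@(_ , L⊆G , _) E⊆H x∈ y∈ e∈ e'∈ xe∼ye' =
    independent-∼⇒≡ L-indep x∈ y∈
      (∼-trans gx gxe gy (∼-mul gx he) (∼-trans gxe gye' gy xe∼ye' (∼-sym gy gye' (∼-mul gy he'))))
    where
    gx : G x
    gx = L⊆G x x∈
    gy : G y
    gy = L⊆G y y∈
    he : H e
    he = All.lookup E⊆H e∈
    he' : H e'
    he' = All.lookup E⊆H e'∈
    gxe : G (mul x e)
    gxe = G-mul x e gx (H⊆G e he)
    gye' : G (mul y e')
    gye' = G-mul y e' gy (H⊆G e' he')

  ⊗-unique : ∀ {L E} → IsIndependent G (Der G) L → All H E → Unique E → Unique (L ⊗ E)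
  ⊗-unique {L} {E} L-indep@(L-unique , L⊆G , _) E⊆H E-unique =
    AllPairs.map⁺ (Unique⇒AllPairs (Unique.cartesianProduct⁺ L-unique E-unique) distinct)
    where
    distinct : ∀ {p q} → p ∈ cartesianProduct L E → q ∈ cartesianProduct L E → p ≢ q →
      uncurry mul p ≢ uncurry mul q
    distinct {x , e} {y , e'} p∈ q∈ p≢q xe≡ye'
      with ∈-cartesianProduct⁻ L E p∈ | ∈-cartesianProduct⁻ L E q∈
    ... | x∈ , e∈ | y∈ , e'∈ with ⊗-same-row L-indep E⊆H x∈ y∈ e∈ e'∈ (equal xe≡ye')
    ... | refl = p≢q (cong (x ,_) (mul-cancelˡ x (perm x (L⊆G x x∈)) xe≡ye'))

  ⊗-⊆G : ∀ {L E} → (∀ x → x ∈ L → G x) → All H E → ∀ z → z ∈ L ⊗ E → G z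
  ⊗-⊆G L⊆G E⊆H z z∈ with ∈-⊗⁻ z∈
  ... | x , e , x∈ , e∈ , refl = G-mul x e (L⊆G x x∈) (H⊆G e (All.lookup E⊆H e∈))

  module _ (D : Subset n) (D⊆Der : ∀ σ → D σ → Der G σ) (D-inv : ∀ σ → D σ → D (inv σ)) where

    clique-unique : ∀ {F} → All G F → AllPairs (CayAdj D) F → Unique F
    clique-unique [] [] = []
    clique-unique {x ∷ _} (gx ∷ gF) (adj ∷ adjs) =
      All.map (λ { d refl → ¬Der-⁻¹·-self x gx (D⊆Der _ d) }) adj ∷ clique-unique gF adjs

    ⊗-nonadjacent : ∀ {L E} → IsIndependent G (Der G) L → All H E → AllPairs (CayAdj D) E →
      ∀ z w → z ∈ L ⊗ E → w ∈ L ⊗ E → ¬ CayAdj (Der G ∖ D) z w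
    ⊗-nonadjacent L-indep@(_ , L⊆G , _) E⊆H E-clique z w z∈ w∈ adj with ∈-⊗⁻ z∈ | ∈-⊗⁻ w∈
    ... | x , e , x∈ , e∈ , refl | y , e' , y∈ , e'∈ , refl
      with ⊗-same-row L-indep E⊆H x∈ y∈ e∈ e'∈ (apart (proj₂ (proj₁ adj)))
    ... | refl = related (AllPairs⇒∈-related E-clique e∈ e'∈)
      where
      gx : G x
      gx = L⊆G x x∈
      ge : G e
      ge = H⊆G e (All.lookup E⊆H e∈)
      ge' : G e'
      ge' = H⊆G e' (All.lookup E⊆H e'∈)
      ⁻¹·-row : mul x e ⁻¹· mul x e' ≡ e ⁻¹· e'
      ⁻¹·-row = ⁻¹·-mul-mul x e (perm x gx) (perm e ge) e'
      related : e ≡ e' ⊎ CayAdj D e e' ⊎ CayAdj D e' e → ⊥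
      related (inj₁ refl) = ¬Der-⁻¹·-self (mul x e) (G-mul x e gx ge) (proj₁ adj)
      related (inj₂ (inj₁ e~e')) = proj₂ adj (subst D (sym ⁻¹·-row) e~e')
      related (inj₂ (inj₂ e'~e)) =
        proj₂ adj (subst D (sym ⁻¹·-row) (CayAdj-sym D-inv e' e (perm e' ge') (perm e ge) e'~e))

    ⊗-independent : ∀ {L E} → IsIndependent G (Der G) L → All H E → AllPairs (CayAdj D) E →
      IsIndependent G (Der G ∖ D) (L ⊗ E)
    ⊗-independent L-indep@(_ , L⊆G , _) E⊆H E-clique =
      ⊗-unique L-indep E⊆H (clique-unique (All.map (H⊆G _) E⊆H) E-clique) ,
      ⊗-⊆G L⊆G E⊆H , ⊗-nonadjacent L-indep E⊆H E-clique

    independent-⊗-clique : ∀ {a E} → IsIndepNumber G (Der G) a → All H E → AllPairs (CayAdj D) E →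
      ∃ λ L → IsIndependent G (Der G ∖ D) L × length L ≡ length E * a
    independent-⊗-clique {E = E} ((L , L-indep , refl) , _) E⊆H E-clique =
      L ⊗ E , ⊗-independent L-indep E⊆H E-clique , trans (length-⊗ L E) (*-comm (length L) (length E))

    independent-doubled : ∀ {a σ} → IsIndepNumber G (Der G) a → D σ →
      ∃ λ L → IsIndependent G (Der G ∖ D) L × length L ≡ 2 * a
    independent-doubled {σ = σ} α dσ = independent-⊗-clique α
      (inj₂ refl ∷ inj₁ (D⊆Der σ dσ) ∷ []) ((subst D (sym (idP-⁻¹· σ)) dσ ∷ []) ∷ [] ∷ [])

  module _ (h : Map n) (h-der : Der G h) where

    private
      h-inj : IsPerm h
      h-inj = perm h (proj₁ h-der)
      h≢idP : h ≢ idP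
      h≢idP = derangement≢idP i₀ (proj₂ h-der)

    open PairProperties h h-inj h≢idP

    Pair⊆Der : ∀ σ → Pair h σ → Der G σ
    Pair⊆Der σ (inj₁ refl) = h-der
    Pair⊆Der σ (inj₂ refl) = Der-inv h h-der

    adjacent⇒⁻¹·≢ : ∀ x y z → G x → G y → CayAdj (Pair h) y z → x ⁻¹· y ≢ x ⁻¹· z
    adjacent⇒⁻¹·≢ x y z gx gy adj eq with ⁻¹·-cancelˡ x (perm x gx) {y} {z} eq
    ... | refl = idP∉Pair (subst (Pair h) (inverseˡ y (perm y gy)) adj)

    cliques≤3 : CliquesBoundedBy (Pair h) 3
    cliques≤3 [] _ _ = z≤n
    cliques≤3 (_ ∷ []) _ _ = s≤s z≤n
    cliques≤3 (_ ∷ _ ∷ []) _ _ = s≤s (s≤s z≤n)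
    cliques≤3 (_ ∷ _ ∷ _ ∷ []) _ _ = s≤s (s≤s (s≤s z≤n))
    cliques≤3 (x ∷ y ∷ z ∷ w ∷ _) (gx ∷ gy ∷ gz ∷ _) ((xy ∷ xz ∷ xw ∷ _) ∷ (yz ∷ yw ∷ _) ∷ (zw ∷ _) ∷ _)
      with Pair-pigeonhole xy xz xw
    ... | inj₁ eq = ⊥-elim (adjacent⇒⁻¹·≢ x y z gx gy yz eq)
    ... | inj₂ (inj₁ eq) = ⊥-elim (adjacent⇒⁻¹·≢ x y w gx gy yw eq)
    ... | inj₂ (inj₂ eq) = ⊥-elim (adjacent⇒⁻¹·≢ x z w gx gz zw eq)

    cliques≤2 : ¬ HasOrder h 3 → CliquesBoundedBy (Pair h) 2
    cliques≤2 _ [] _ _ = z≤n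
    cliques≤2 _ (_ ∷ []) _ _ = s≤s z≤n
    cliques≤2 _ (_ ∷ _ ∷ []) _ _ = s≤s (s≤s z≤n)
    cliques≤2 ¬order3 (x ∷ y ∷ z ∷ _) (gx ∷ gy ∷ _) ((xy ∷ xz ∷ _) ∷ (yz ∷ _) ∷ _) =
      ⊥-elim (¬order3 (triangle⇒order3 xy xz
        (subst (Pair h) (sym (⁻¹·-translate x y (perm x gx) (perm y gy) z)) yz)))

    indepNumber-without-Pair : ∀ a → IsIndepNumber G (Der G) a →
      (¬ HasOrder h 3 → IsIndepNumber G (Der G ∖ Pair h) (2 * a)) ×
      (HasOrder h 3 → IsIndepNumber G (Der G ∖ Pair h) (3 * a))
    indepNumber-without-Pair a α =
      (λ ¬order3 → independent-doubled (Pair h) Pair⊆Der Pair-inv α (inj₁ refl)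
                 , independent-length≤ Pair? α (cliques≤2 ¬order3)) ,
      (λ order3 → independent-⊗-clique (Pair h) Pair⊆Der Pair-inv α
                    (inj₂ refl ∷ inj₁ h-der ∷ H-inv h (inj₁ h-der) ∷ [])
                    ((inj₁ (idP-⁻¹· h) ∷ inj₂ (idP-⁻¹· (inv h)) ∷ [])
                     ∷ (inj₁ (order3⇒inv²≡ order3) ∷ []) ∷ [] ∷ [])
                , independent-length≤ Pair? α cliques≤3)

  no-indepNumber-between : ∀ D → (∀ σ → D σ → Der G σ) → (∀ σ → D σ → D (inv σ)) →
    ∀ a b → IsIndepNumber G (Der G) a → IsIndepNumber G (Der G ∖ D) b → ¬ (a < b × b < 2 * a)
  no-indepNumber-between D D⊆Der D-inv a b α ((L , (L-unique , L⊆G , L-indep) , refl) , maximal)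
                         (a<b , b<2a) =
    <⇒≱ a<b (proj₂ α L (L-unique , L⊆G , λ x y x∈ y∈ der → L-indep x y x∈ y∈ (der , D-empty _)))
    where
    D-empty : ∀ σ → ¬ D σ
    D-empty σ dσ with independent-doubled D D⊆Der D-inv α dσ
    ... | L' , L'-indep , |L'|≡2a = <⇒≱ b<2a (subst (_≤ length L) |L'|≡2a (maximal L' L'-indep))

corollary3p3 : (n : ℕ) → 1 ≤ n → (G : Subset n) → IsPermGroup G → IsTransitive G →
    IsSubgroupOf (DerId G) G →
    ((h : Map n) → Der G h → (a : ℕ) → IsIndepNumber G (Der G) a →
    (¬ HasOrder h 3 → IsIndepNumber G (Der G ∖ Pair h) (2 * a)) ×
    (HasOrder h 3 → IsIndepNumber G (Der G ∖ Pair h) (3 * a))) ×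
    ((D : Subset n) → (∀ σ → D σ → Der G σ) → (∀ σ → D σ → D (inv σ)) →
    (a b : ℕ) → IsIndepNumber G (Der G) a → IsIndepNumber G (Der G ∖ D) b →
    ¬ (a < b × b < 2 * a))
corollary3p3 n n≥1 G G-group _ H-subgroup = indepNumber-without-Pair , no-indepNumber-between
  where open CosetCounting (fromℕ< n≥1) G G-group H-subgroup
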